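{- Let $S$ be a finite subset of $\mathbb{Z}$, let $\omega = x_1x_2x_3\cdots$ be an infinite word with all $x_i \in S$, and let $k > 1$ be an integer. Then $\omega$ contains a factor $U_1U_2\cdots U_k$ (a concatenation of $k$ consecutive nonempty factors) such that $$\frac{1}{|U_1|}\sum U_1 = \frac{1}{|U_2|}\sum U_2 = \cdots = \frac{1}{|U_k|}\sum U_k.$$
   Context: A factor of $\omega = x_1x_2x_3\cdots$ is a finite nonempty block $x_ix_{i+1}\cdots x_{i+n}$ of consecutive letters. For such a factor $B$, $|B| = n+1$ is its length and $\sum B = x_i + \cdots + x_{i+n}$ is the sum of its letters; $\frac{1}{|B|}\sum B$ is its average. -}

module Defs where

open import Data.Nat using (ℕ; zero; suc; _+_)
open import Data.Integer using (ℤ; +_)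
import Data.Integer as ℤ
open import Data.Rational.Unnormalised using (ℚᵘ; mkℚᵘ)

-- An infinite word over ℤ: ω i is the letter x_{i+1} (0-indexed).
Word : Set
Word = ℕ → ℤ

blockSum : Word → ℕ → ℕ → ℤ
blockSum ω p zero    = + 0
blockSum ω p (suc n) = ω p ℤ.+ blockSum ω (suc p) n

-- Average of the nonempty factor starting at p of length (suc n):
--   (1 / (suc n)) * Σ  as an unnormalised rational.
average : Word → ℕ → ℕ → ℚᵘ
average ω p n = mkℚᵘ (blockSum ω p (suc n)) n

open import Data.Fin using (Fin; zero; suc)

-- Given start p and lengths-minus-one ℓ (so |U_j| = suc (ℓ j)),
-- start position of block j.
blockStart : {k : ℕ} → ℕ → (Fin k → ℕ) → Fin k → ℕ
blockStart p ℓ zero    = p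
blockStart p ℓ (suc j) = blockStart (p + suc (ℓ zero)) (λ i → ℓ (suc i)) j

blockAverage : {k : ℕ} → Word → ℕ → (Fin k → ℕ) → Fin k → ℚᵘ
blockAverage ω p ℓ j = average ω (blockStart p ℓ j) (ℓ j)

module Submission where

open import Defs
open import Data.Nat using (ℕ; _<_)
open import Data.Integer using (ℤ)
open import Data.List using (List)
open import Data.List.Membership.Propositional using (_∈_)
open import Data.Fin using (Fin)
open import Data.Product using (Σ)
open import Data.Rational.Unnormalised using (_≃_)

open import Data.Nat using (zero; suc; _+_; _*_; _∸_; _⊔_; _≤_; z≤n; s≤s; _<?_; NonZero)
import Data.Nat.Properties as ℕ
open import Data.Nat.DivMod using (_/_; _%_; m≡m%n+[m/n]*n; m%n<n; m<n*o⇒m/o<n; m/n*n≤m; /-monoˡ-≤)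
open import Data.Nat.ListAction using (sum)
open import Data.Nat.Tactic.RingSolver using (solve-∀)
open import Data.Integer using (+_; -[1+_]; 0ℤ; 1ℤ; -1ℤ; _⊖_)
import Data.Integer as ℤ
import Data.Integer.Properties as ℤ
import Data.Integer.Tactic.RingSolver as ℤSolver
open import Data.Rational.Unnormalised using (mkℚᵘ; *≡*)
open import Data.Sign using (Sign)
import Data.Sign.Properties as Sign
import Data.Fin as Fin
open import Data.Product using (_,_; _×_)
open import Data.Product.Properties using (≡-dec)
open import Data.Sum using (_⊎_; inj₁; inj₂)
import Data.Sum as Sum
open import Data.Empty using (⊥-elim)
open import Data.List using ([]; _∷_; length; filter; map; upTo; applyUpTo; _++_; cartesianProduct)
import Data.List.Properties as List
open import Data.List.Relation.Unary.All as All using (All; []; _∷_)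
import Data.List.Relation.Unary.All.Properties as All
open import Data.List.Relation.Unary.Any using (here; there; any?)
open import Data.List.Relation.Unary.Linked using (Linked; []; [-]; _∷_)
import Data.List.Relation.Unary.Linked.Properties as Linked
open import Data.List.Membership.Propositional using (find)
open import Data.List.Membership.Propositional.Properties
  using (∈-upTo⁺; ∈-upTo⁻; ∈-applyUpTo⁻; ∈-map⁺; ∈-++⁺ˡ; ∈-++⁺ʳ; ∈-cartesianProduct⁺)
open import Data.List.Relation.Binary.Subset.Propositional using (_⊆_)
open import Data.List.Relation.Binary.Subset.Propositional.Properties using (filter-⊆)
open import Function using (_∘_; id)
open import Relation.Binary.Definitions using (DecidableEquality; Transitive)
open import Relation.Binary.PropositionalEquality
open import Relation.Nullary using (yes; no; ¬_; ¬?)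
open import Relation.Unary using (Decidable)

-- Shift the letters to ν i = ω i + M ∈ [0, D] (|ω i| ≤ M) and let T be their
-- prefix sums.  For a slope num/den, the deviation dev(n) = den·T(n) − num·n
-- has equal values at positions p₀ < ⋯ < p_k exactly when the k blocks between
-- them all have average num/den − M; so it suffices to find k + 1 such
-- "collinear" positions.
--
-- Take windows (A, B] one after the other.  By Dirichlet, approximate T(B)/B by
-- a/b with b ≤ Q = 4k + 1.  If the deviation from a/b stays in [−(A+1), A+1]
-- on the window, pigeonhole on its values finishes.  Otherwise, for the sign s
-- of the excursion, the deviation from the perturbed slope (Q·a + s)/(Q·b)
-- changes sign inside the window, and where it does it takes a small value.
-- Each window therefore yields an "event" (position, slope, value) whose
-- colour (slope, value) lies in a finite list, and pigeonhole over k·|colours|+1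
-- events gives k + 1 positions with the same slope and value.

module Pigeonhole {E C : Set} (_≟_ : DecidableEquality C) (colour : E → C)
                  {_≺_ : E → E → Set} (≺-trans : Transitive _≺_) where

  length-split : ∀ c xs → length (filter (λ e → colour e ≟ c) xs)
                          + length (filter (λ e → ¬? (colour e ≟ c)) xs) ≡ length xs
  length-split c [] = refl
  length-split c (x ∷ xs) with colour x ≟ c
  ... | yes _ = cong suc (length-split c xs)
  ... | no _  = trans (ℕ.+-suc _ _) (cong suc (length-split c xs))

  pigeonhole : ∀ j cs (xs : List E) → Linked _≺_ xs → All (λ e → colour e ∈ cs) xs →
               j * length cs < length xs →
               Σ C λ c → Σ (List E) λ ys →
                 ys ⊆ xs × Linked _≺_ ys × All (λ e → colour e ≡ c) ys × j < length ys
  pigeonhole j [] [] _ _ ()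
  pigeonhole j [] (x ∷ xs) _ (() ∷ _) _
  pigeonhole j (c ∷ cs) xs chain coloured count with j <? length (filter (λ e → colour e ≟ c) xs)
  ... | yes many = c , _ , filter-⊆ _ xs , Linked.filter⁺ _ ≺-trans chain , All.all-filter _ xs , many
  ... | no few with pigeonhole j cs rest (Linked.filter⁺ _ ≺-trans chain) coloured′ count′
    where
      rest = filter (λ e → ¬? (colour e ≟ c)) xs
      coloured′ : All (λ e → colour e ∈ cs) rest
      coloured′ = All.map (λ { (here eq , ne) → ⊥-elim (ne eq) ; (there m , _) → m })
                          (All.zip (All.filter⁺ _ coloured , All.all-filter _ xs))
      -- at most j elements were removed, so more than j·|cs| remain
      count′ : j * length cs < length rest
      count′ = ℕ.+-cancelˡ-< j _ _ (begin-strict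
        j + j * length cs          ≡⟨ ℕ.*-suc j (length cs) ⟨
        j * suc (length cs)        <⟨ count ⟩
        length xs                  ≡⟨ length-split c xs ⟨
        _ + length rest            ≤⟨ ℕ.+-monoˡ-≤ (length rest) (ℕ.≮⇒≥ few) ⟩
        j + length rest            ∎)
        where open ℕ.≤-Reasoning
  ...   | c′ , ys , ys⊆rest , rest′ = c′ , ys , filter-⊆ _ xs ∘ ys⊆rest , rest′

last-before-exit : {P : ℕ → Set} → Decidable P → ∀ {u v} → u ≤ v → P u → ¬ P v →
                 Σ ℕ λ m → u ≤ m × m < v × P m × ¬ P (suc m)
last-before-exit P? {u} {zero} z≤n Pu ¬Pv = ⊥-elim (¬Pv Pu)
last-before-exit P? {u} {suc v} u≤ Pu ¬Psv with ℕ.m≤n⇒m<n∨m≡n u≤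
... | inj₂ refl = ⊥-elim (¬Psv Pu)
... | inj₁ (s≤s u≤v) with P? v
...   | yes Pv = v , u≤v , ℕ.≤-refl , Pv , ¬Psv
...   | no ¬Pv with last-before-exit P? u≤v Pu ¬Pv
...     | m , u≤m , m<v , Pm , ¬Psm = m , u≤m , ℕ.m≤n⇒m≤1+n m<v , Pm , ¬Psm

intRange : ℕ → List ℤ
intRange R = map +_ (upTo (suc R)) ++ map -[1+_] (upTo R)

length-intRange : ∀ R → length (intRange R) ≡ suc R + R
length-intRange R = begin
  length (intRange R)                                         ≡⟨ List.length-++ (map +_ (upTo (suc R))) ⟩
  length (map +_ (upTo (suc R))) + length (map -[1+_] (upTo R)) ≡⟨ cong₂ _+_ (List.length-map _ (upTo (suc R))) (List.length-map _ (upTo R)) ⟩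
  length (upTo (suc R)) + length (upTo R)                     ≡⟨ cong₂ _+_ (List.length-upTo (suc R)) (List.length-upTo R) ⟩
  suc R + R                                                   ∎
  where open ≡-Reasoning

∈-intRange : ∀ {R} i → ℤ.∣ i ∣ ≤ R → i ∈ intRange R
∈-intRange (+ n)      n≤R  = ∈-++⁺ˡ (∈-map⁺ +_ (∈-upTo⁺ (s≤s n≤R)))
∈-intRange -[1+ n ] 1+n≤R = ∈-++⁺ʳ _ (∈-map⁺ -[1+_] (∈-upTo⁺ 1+n≤R))

unit : Sign → ℤ
unit Sign.+ = 1ℤ
unit Sign.- = -1ℤ

unit-square : ∀ s → unit s ℤ.* unit s ≡ 1ℤ
unit-square Sign.+ = refl
unit-square Sign.- = refl

∣unit*i∣ : ∀ s i → ℤ.∣ unit s ℤ.* i ∣ ≡ ℤ.∣ i ∣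
∣unit*i∣ Sign.+ i = trans (ℤ.abs-* 1ℤ i) (ℕ.*-identityˡ ℤ.∣ i ∣)
∣unit*i∣ Sign.- i = trans (ℤ.abs-* -1ℤ i) (ℕ.*-identityˡ ℤ.∣ i ∣)

i≤∣i∣ : ∀ i → i ℤ.≤ + ℤ.∣ i ∣
i≤∣i∣ (+ n)      = ℤ.≤-refl
i≤∣i∣ -[1+ n ] = ℤ.-≤+

unit*i≤∣i∣ : ∀ s i → unit s ℤ.* i ℤ.≤ + ℤ.∣ i ∣
unit*i≤∣i∣ s i = subst (λ n → unit s ℤ.* i ℤ.≤ + n) (∣unit*i∣ s i) (i≤∣i∣ (unit s ℤ.* i))

unit*i≡∣i∣ : ∀ i → Σ Sign λ s → unit s ℤ.* i ≡ + ℤ.∣ i ∣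
unit*i≡∣i∣ i with ℤ.+∣i∣≡i⊎+∣i∣≡-i i
... | inj₁ eq = Sign.+ , trans (ℤ.*-identityˡ i) (sym eq)
... | inj₂ eq = Sign.- , trans (ℤ.-1*i≡-i i) (sym eq)

jump-exceeds : ∀ {x y} → 0ℤ ℤ.< x → y ℤ.≤ 0ℤ → ℤ.∣ y ∣ < ℤ.∣ y ℤ.- x ∣
jump-exceeds (ℤ.+<+ (s≤s {n = p} _)) (ℤ.+≤+ z≤n) = s≤s z≤n
jump-exceeds {y = -[1+ q ]} (ℤ.+<+ (s≤s {n = p} _)) ℤ.-≤+ = s≤s (s≤s (ℕ.m≤m+n q p))

0<i-j : ∀ {i j} → j ℤ.< i → 0ℤ ℤ.< i ℤ.- j
0<i-j {i} {j} j<i = subst (ℤ._< i ℤ.- j) (ℤ.+-inverseʳ j) (ℤ.+-monoˡ-< (ℤ.- j) j<i)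

shift-nonneg : ∀ {M} x → ℤ.∣ x ∣ ≤ M → + ℤ.∣ x ℤ.+ + M ∣ ≡ x ℤ.+ + M
shift-nonneg (+ n)      _ = refl
shift-nonneg -[1+ n ] h rewrite ℤ.⊖-≥ h = refl

shift-bound : ∀ {M} x → ℤ.∣ x ∣ ≤ M → ℤ.∣ x ℤ.+ + M ∣ ≤ M + M
shift-bound {M} (+ n)      h = ℕ.+-monoˡ-≤ M h
shift-bound {M} -[1+ n ] h rewrite ℤ.⊖-≥ h = ℕ.≤-trans (ℕ.m∸n≤m M (suc n)) (ℕ.m≤m+n M M)

same-ratio⇒equal-average : ∀ den .{{_ : NonZero den}} r s₁ s₂ l₁ l₂ →
  + den ℤ.* s₁ ≡ r ℤ.* + suc l₁ → + den ℤ.* s₂ ≡ r ℤ.* + suc l₂ → mkℚᵘ s₁ l₁ ≃ mkℚᵘ s₂ l₂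
same-ratio⇒equal-average den r s₁ s₂ l₁ l₂ e₁ e₂ = *≡* (ℤ.*-cancelˡ-≡ (+ den) _ _ (begin
  + den ℤ.* (s₁ ℤ.* + suc l₂)   ≡⟨ ℤ.*-assoc (+ den) s₁ (+ suc l₂) ⟨
  (+ den ℤ.* s₁) ℤ.* + suc l₂   ≡⟨ cong (ℤ._* + suc l₂) e₁ ⟩
  (r ℤ.* + suc l₁) ℤ.* + suc l₂   ≡⟨ swap r (+ suc l₁) (+ suc l₂) ⟩
  (r ℤ.* + suc l₂) ℤ.* + suc l₁   ≡⟨ cong (ℤ._* + suc l₁) e₂ ⟨
  (+ den ℤ.* s₂) ℤ.* + suc l₁   ≡⟨ ℤ.*-assoc (+ den) s₂ (+ suc l₁) ⟩
  + den ℤ.* (s₂ ℤ.* + suc l₁)   ∎))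
  where
    open ≡-Reasoning
    swap : ∀ x y z → (x ℤ.* y) ℤ.* z ≡ (x ℤ.* z) ℤ.* y
    swap = ℤSolver.solve-∀

⊖-balance : ∀ x y u v → x + u ≡ v + y → x ⊖ y ≡ v ⊖ u
⊖-balance x y u v eq = begin
  x ⊖ y                 ≡⟨ ℤ.+-cancelˡ-⊖ u x y ⟨
  (u + x) ⊖ (u + y)     ≡⟨ cong₂ _⊖_ (trans (ℕ.+-comm u x) (trans eq (ℕ.+-comm v y))) (ℕ.+-comm u y) ⟩
  (y + v) ⊖ (y + u)     ≡⟨ ℤ.+-cancelˡ-⊖ y v u ⟩
  v ⊖ u                 ∎
  where open ≡-Reasoning

remainder-identity : ∀ Q N t b a j₀ q₀ r₀ r₁ c ρ₀ ρ₁ →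
  j₀ * t ≡ r₀ + q₀ * N → (b + j₀) * t ≡ r₁ + (a + q₀) * N →
  Q * r₀ ≡ ρ₀ + c * N → Q * r₁ ≡ ρ₁ + c * N → Q * (b * t) + ρ₀ ≡ ρ₁ + Q * (a * N)
remainder-identity Q N t b a j₀ q₀ r₀ r₁ c ρ₀ ρ₁ h₀ h₁ e₀ e₁ =
  ℕ.+-cancelʳ-≡ (c * N + Q * (q₀ * N)) _ _ (begin
    (Q * (b * t) + ρ₀) + (c * N + Q * (q₀ * N)) ≡⟨ shuffle₁ Q b t ρ₀ c N q₀ ⟩
    Q * (b * t) + (ρ₀ + c * N) + Q * (q₀ * N)   ≡⟨ cong (λ z → Q * (b * t) + z + Q * (q₀ * N)) e₀ ⟨
    Q * (b * t) + Q * r₀ + Q * (q₀ * N)         ≡⟨ shuffle₂ Q b t r₀ q₀ N ⟩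
    Q * (b * t) + Q * (r₀ + q₀ * N)             ≡⟨ cong (λ z → Q * (b * t) + Q * z) h₀ ⟨
    Q * (b * t) + Q * (j₀ * t)                  ≡⟨ shuffle₃ Q b t j₀ ⟩
    Q * ((b + j₀) * t)                          ≡⟨ cong (Q *_) h₁ ⟩
    Q * (r₁ + (a + q₀) * N)                     ≡⟨ shuffle₄ Q r₁ a q₀ N ⟩
    Q * r₁ + Q * (a * N) + Q * (q₀ * N)         ≡⟨ cong (λ z → z + Q * (a * N) + Q * (q₀ * N)) e₁ ⟩
    (ρ₁ + c * N) + Q * (a * N) + Q * (q₀ * N)   ≡⟨ shuffle₅ ρ₁ c N Q a q₀ ⟩
    ρ₁ + Q * (a * N) + (c * N + Q * (q₀ * N))   ∎)
  where
    open ≡-Reasoning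
    shuffle₁ : ∀ Q b t ρ₀ c N q₀ → (Q * (b * t) + ρ₀) + (c * N + Q * (q₀ * N))
                                   ≡ Q * (b * t) + (ρ₀ + c * N) + Q * (q₀ * N)
    shuffle₁ = solve-∀
    shuffle₂ : ∀ Q b t r₀ q₀ N → Q * (b * t) + Q * r₀ + Q * (q₀ * N) ≡ Q * (b * t) + Q * (r₀ + q₀ * N)
    shuffle₂ = solve-∀
    shuffle₃ : ∀ Q b t j₀ → Q * (b * t) + Q * (j₀ * t) ≡ Q * ((b + j₀) * t)
    shuffle₃ = solve-∀
    shuffle₄ : ∀ Q r₁ a q₀ N → Q * (r₁ + (a + q₀) * N) ≡ Q * r₁ + Q * (a * N) + Q * (q₀ * N)
    shuffle₄ = solve-∀
    shuffle₅ : ∀ ρ₁ c N Q a q₀ → (ρ₁ + c * N) + Q * (a * N) + Q * (q₀ * N)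
                                 ≡ ρ₁ + Q * (a * N) + (c * N + Q * (q₀ * N))
    shuffle₅ = solve-∀

-- Dirichlet's approximation theorem: for Q, N ≥ 1 and any t there are
-- 1 ≤ b ≤ Q and a ≤ Q·t/N with |Q·b·t − Q·a·N| < N, i.e. |b·t/N − a| < 1/Q.
-- Proof: two of the Q + 1 numbers ⌊Q·frac(j·t/N)⌋, j ≤ Q, lie in the same of Q boxes.
dirichlet : ∀ Q N t .{{_ : NonZero Q}} .{{_ : NonZero N}} →
            Σ ℕ λ b → Σ ℕ λ a → 1 ≤ b × b ≤ Q × a * N ≤ Q * t ×
              ℤ.∣ (Q * (b * t)) ⊖ (Q * (a * N)) ∣ < N
dirichlet Q N t with Pigeonhole.pigeonhole ℕ._≟_ box ℕ.<-trans 1 (upTo Q) (upTo (suc Q))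
                       (Linked.applyUpTo⁺₂ id (suc Q) ℕ.n<1+n)
                       (All.tabulate (λ {j} _ → ∈-upTo⁺ (box<Q j)))
                       (subst₂ _<_ (sym (trans (ℕ.*-identityˡ _) (List.length-upTo Q)))
                                   (sym (List.length-upTo (suc Q))) (ℕ.n<1+n Q))
  where
    box : ℕ → ℕ
    box j = (Q * ((j * t) % N)) / N
    box<Q : ∀ j → box j < Q
    box<Q j = m<n*o⇒m/o<n (ℕ.*-monoʳ-< Q (m%n<n (j * t) N))
... | _ , [] , _ , _ , _ , ()
... | _ , (_ ∷ []) , _ , _ , _ , s≤s ()
... | _ , (j₀ ∷ j₁ ∷ _) , ys⊆ , (j₀<j₁ ∷ _) , (box₀ ∷ box₁ ∷ _) , _ =
  b , a , ℕ.m<n⇒0<n∸m j₀<j₁ , ℕ.≤-trans (ℕ.m∸n≤m j₁ j₀) j₁≤Q , aN≤Qt , distance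
  where
    j₁≤Q : j₁ ≤ Q
    j₁≤Q = ℕ.≤-pred (∈-upTo⁻ (ys⊆ (there (here refl))))
    b = j₁ ∸ j₀
    q₀ = (j₀ * t) / N
    q₁ = (j₁ * t) / N
    r₀ = (j₀ * t) % N
    r₁ = (j₁ * t) % N
    a = q₁ ∸ q₀
    ρ₀ = (Q * r₀) % N
    ρ₁ = (Q * r₁) % N
    b+j₀ : b + j₀ ≡ j₁
    b+j₀ = ℕ.m∸n+n≡m (ℕ.<⇒≤ j₀<j₁)
    a+q₀ : a + q₀ ≡ q₁
    a+q₀ = ℕ.m∸n+n≡m (/-monoˡ-≤ N (ℕ.*-monoˡ-≤ t (ℕ.<⇒≤ j₀<j₁)))
    division₁ : (b + j₀) * t ≡ r₁ + (a + q₀) * N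
    division₁ rewrite b+j₀ | a+q₀ = m≡m%n+[m/n]*n (j₁ * t) N
    sameBox : Q * r₁ ≡ ρ₁ + ((Q * r₀) / N) * N
    sameBox = trans (m≡m%n+[m/n]*n (Q * r₁) N) (cong (λ z → ρ₁ + z * N) (trans box₁ (sym box₀)))
    aN≤Qt : a * N ≤ Q * t
    aN≤Qt = ℕ.≤-trans (ℕ.*-monoˡ-≤ N (ℕ.m∸n≤m q₁ q₀))
              (ℕ.≤-trans (m/n*n≤m (j₁ * t) N) (ℕ.*-monoˡ-≤ t j₁≤Q))
    exact : Q * (b * t) + ρ₀ ≡ ρ₁ + Q * (a * N)
    exact = remainder-identity Q N t b a j₀ q₀ r₀ r₁ ((Q * r₀) / N) ρ₀ ρ₁
              (m≡m%n+[m/n]*n (j₀ * t) N) division₁ (m≡m%n+[m/n]*n (Q * r₀) N) sameBox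
    distance : ℤ.∣ (Q * (b * t)) ⊖ (Q * (a * N)) ∣ < N
    distance = begin-strict
      ℤ.∣ (Q * (b * t)) ⊖ (Q * (a * N)) ∣ ≡⟨ cong ℤ.∣_∣ (⊖-balance _ _ ρ₀ ρ₁ exact) ⟩
      ℤ.∣ ρ₁ ⊖ ρ₀ ∣                         ≤⟨ ℤ.∣m⊝n∣≤m⊔n ρ₁ ρ₀ ⟩
      ρ₁ ⊔ ρ₀                               <⟨ ℕ.⊔-lub (m%n<n (Q * r₁) N) (m%n<n (Q * r₀) N) ⟩
      N                                     ∎
      where open ℕ.≤-Reasoning

module Blocks (ω : Word) (M : ℕ) (bounded : ∀ i → ℤ.∣ ω i ∣ ≤ M) (k : ℕ) where

  EqualAverageBlocks : Set
  EqualAverageBlocks = Σ ℕ λ p → Σ (Fin k → ℕ) λ ℓ →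
    ∀ (i j : Fin k) → blockAverage ω p ℓ i ≃ blockAverage ω p ℓ j

  D : ℕ
  D = M + M

  ν : ℕ → ℕ
  ν n = ℤ.∣ ω n ℤ.+ + M ∣

  ν-bound : ∀ n → ν n ≤ D
  ν-bound n = shift-bound (ω n) (bounded n)

  T : ℕ → ℕ
  T zero    = 0
  T (suc n) = T n + ν n

  T-bound : ∀ n → T n ≤ D * n
  T-bound zero    = z≤n
  T-bound (suc n) = ℕ.≤-trans (ℕ.+-mono-≤ (T-bound n) (ν-bound n))
                      (ℕ.≤-reflexive (trans (ℕ.+-comm (D * n) D) (sym (ℕ.*-suc D n))))

  T-block : ∀ L p → + T (L + p) ≡ + T p ℤ.+ (blockSum ω p L ℤ.+ + L ℤ.* + M)
  T-block zero    p = sym (ℤ.+-identityʳ (+ T p))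
  T-block (suc L) p = begin
    + T (suc L + p)                                  ≡⟨ cong (λ x → + T x) (ℕ.+-suc L p) ⟨
    + T (L + suc p)                                  ≡⟨ T-block L (suc p) ⟩
    + (T p + ν p) ℤ.+ rest                           ≡⟨ cong (ℤ._+ rest) (ℤ.pos-+ (T p) (ν p)) ⟩
    (+ T p ℤ.+ + ν p) ℤ.+ rest                       ≡⟨ cong (λ x → (+ T p ℤ.+ x) ℤ.+ rest) (shift-nonneg (ω p) (bounded p)) ⟩
    (+ T p ℤ.+ (ω p ℤ.+ + M)) ℤ.+ rest               ≡⟨ regroup (+ T p) (ω p) (blockSum ω (suc p) L) (+ L) (+ M) ⟩
    + T p ℤ.+ (blockSum ω p (suc L) ℤ.+ + suc L ℤ.* + M) ∎
    where
      open ≡-Reasoning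
      rest = blockSum ω (suc p) L ℤ.+ + L ℤ.* + M
      regroup : ∀ t x s l m → (t ℤ.+ (x ℤ.+ m)) ℤ.+ (s ℤ.+ l ℤ.* m) ≡ t ℤ.+ ((x ℤ.+ s) ℤ.+ (1ℤ ℤ.+ l) ℤ.* m)
      regroup = ℤSolver.solve-∀

  dev : ℤ → ℕ → ℕ → ℤ
  dev num den n = + den ℤ.* + T n ℤ.- num ℤ.* + n

  HasRatio : ℤ → ℕ → ℕ → ℕ → Set
  HasRatio r den p L = + den ℤ.* blockSum ω p L ≡ r ℤ.* + L

  equal-dev⇒ratio : ∀ num den L p → dev num den (L + p) ≡ dev num den p →
                    HasRatio (num ℤ.- + den ℤ.* + M) den p L
  equal-dev⇒ratio num den L p same = ℤ.i-j≡0⇒i≡j _ _ (begin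
    + den ℤ.* B ℤ.- (num ℤ.- + den ℤ.* + M) ℤ.* + L
      ≡⟨ expand (+ den) (+ T p) B (+ L) (+ M) num (+ p) ⟩
    (+ den ℤ.* (+ T p ℤ.+ (B ℤ.+ + L ℤ.* + M)) ℤ.- num ℤ.* (+ L ℤ.+ + p)) ℤ.- dev num den p
      ≡⟨ cong₂ (λ x y → (+ den ℤ.* x ℤ.- num ℤ.* y) ℤ.- dev num den p) (T-block L p) (ℤ.pos-+ L p) ⟨
    dev num den (L + p) ℤ.- dev num den p
      ≡⟨ ℤ.i≡j⇒i-j≡0 same ⟩
    0ℤ ∎)
    where
      open ≡-Reasoning
      B = blockSum ω p L
      expand : ∀ d t b l m n q → d ℤ.* b ℤ.- (n ℤ.- d ℤ.* m) ℤ.* l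
                                 ≡ (d ℤ.* (t ℤ.+ (b ℤ.+ l ℤ.* m)) ℤ.- n ℤ.* (l ℤ.+ q)) ℤ.- (d ℤ.* t ℤ.- n ℤ.* q)
      expand = ℤSolver.solve-∀

  staircase : ∀ num den c j p (ys : List ℕ) → Linked _<_ (p ∷ ys) →
              All (λ n → dev num den n ≡ c) (p ∷ ys) → j ≤ length ys →
              Σ (Fin j → ℕ) λ ℓ → ∀ i →
                HasRatio (num ℤ.- + den ℤ.* + M) den (blockStart p ℓ i) (suc (ℓ i))
  staircase num den c zero    p ys       _ _ _ = (λ ()) , (λ ())
  staircase num den c (suc j) p (y ∷ ys) (p<y ∷ chain) (dev-p ∷ devs@(dev-y ∷ _)) (s≤s j≤)
    with staircase num den c j y ys chain devs j≤
  ... | ℓ′ , ratio′ = ℓ , ratio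
    where
      ℓ : Fin (suc j) → ℕ
      ℓ Fin.zero    = y ∸ suc p
      ℓ (Fin.suc i) = ℓ′ i
      first-end : suc (ℓ Fin.zero) + p ≡ y
      first-end = trans (sym (ℕ.+-suc (ℓ Fin.zero) p)) (ℕ.m∸n+n≡m p<y)
      ratio : ∀ i → HasRatio (num ℤ.- + den ℤ.* + M) den (blockStart p ℓ i) (suc (ℓ i))
      ratio Fin.zero    = equal-dev⇒ratio num den (suc (ℓ Fin.zero)) p
                        (trans (cong (dev num den) first-end) (trans dev-y (sym dev-p)))
      ratio (Fin.suc i) = subst (λ x → HasRatio (num ℤ.- + den ℤ.* + M) den (blockStart x ℓ′ i) (suc (ℓ′ i)))
                        (sym (trans (ℕ.+-comm p (suc (ℓ Fin.zero))) first-end)) (ratio′ i)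

  collinear⇒blocks : ∀ num den {{_ : NonZero den}} c (ps : List ℕ) → Linked _<_ ps →
                     All (λ n → dev num den n ≡ c) ps → k < length ps → EqualAverageBlocks
  collinear⇒blocks num den c (p ∷ ps) chain devs (s≤s k≤) =
    let (ℓ , ratio) = staircase num den c k p ps chain devs k≤
    in p , ℓ , λ i j → same-ratio⇒equal-average den (num ℤ.- + den ℤ.* + M) _ _ (ℓ i) (ℓ j) (ratio i) (ratio j)

  -- One step changes the deviation by den·ν n − num, hence by at most den·D + |num|.
  dev-step : ∀ num den n → ℤ.∣ dev num den (suc n) ℤ.- dev num den n ∣ ≤ den * D + ℤ.∣ num ∣
  dev-step num den n = begin
    ℤ.∣ dev num den (suc n) ℤ.- dev num den n ∣        ≡⟨ cong ℤ.∣_∣ increment ⟩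
    ℤ.∣ + den ℤ.* + ν n ℤ.- num ∣                      ≤⟨ ℤ.∣i-j∣≤∣i∣+∣j∣ (+ den ℤ.* + ν n) num ⟩
    ℤ.∣ + den ℤ.* + ν n ∣ + ℤ.∣ num ∣                  ≡⟨ cong (_+ ℤ.∣ num ∣) (ℤ.abs-* (+ den) (+ ν n)) ⟩
    den * ν n + ℤ.∣ num ∣                              ≤⟨ ℕ.+-monoˡ-≤ ℤ.∣ num ∣ (ℕ.*-monoʳ-≤ den (ν-bound n)) ⟩
    den * D + ℤ.∣ num ∣                                ∎
    where
      open ℕ.≤-Reasoning
      difference : ∀ d t v n x → (d ℤ.* (t ℤ.+ v) ℤ.- x ℤ.* (1ℤ ℤ.+ n)) ℤ.- (d ℤ.* t ℤ.- x ℤ.* n) ≡ d ℤ.* v ℤ.- x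
      difference = ℤSolver.solve-∀
      increment : dev num den (suc n) ℤ.- dev num den n ≡ + den ℤ.* + ν n ℤ.- num
      increment = trans (cong (λ t → (+ den ℤ.* t ℤ.- num ℤ.* + suc n) ℤ.- dev num den n) (ℤ.pos-+ (T n) (ν n)))
                        (difference (+ den) (+ T n) (+ ν n) (+ n) num)

  window : ℕ → ℕ → List ℕ
  window A L = applyUpTo (λ i → suc (i + A)) L

  flat-or-excursion : ∀ num den {{_ : NonZero den}} A L R → k * length (intRange R) < L →
    EqualAverageBlocks ⊎ Σ ℕ λ n → A < n × n ≤ L + A × R < ℤ.∣ dev num den n ∣
  flat-or-excursion num den A L R long with any? (λ n → R <? ℤ.∣ dev num den n ∣) (window A L)
  ... | yes excursion with find excursion
  ...   | n , n∈ , far with ∈-applyUpTo⁻ (λ i → suc (i + A)) n∈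
  ...     | i , i<L , refl = inj₂ (suc (i + A) , s≤s (ℕ.m≤n+m A i) , ℕ.+-monoˡ-≤ A i<L , far)
  flat-or-excursion num den A L R long | no flat
    with Pigeonhole.pigeonhole ℤ._≟_ (dev num den) ℕ.<-trans k (intRange R) (window A L)
           (Linked.applyUpTo⁺₂ _ L (λ i → ℕ.n<1+n (suc (i + A))))
           (All.map (λ {n} near → ∈-intRange (dev num den n) (ℕ.≮⇒≥ near)) (All.¬Any⇒All¬ (window A L) flat))
           (subst (k * length (intRange R) <_) (sym (List.length-applyUpTo _ L)) long)
  ... | c , ps , _ , chain , same , many = inj₁ (collinear⇒blocks num den c ps chain same many)

  Q : ℕ
  Q = suc (4 * k)

  -- Perturbing a slope a/(b′+1) to (Q·a + s)/(Q·(b′+1)) for a sign s turns its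
  -- deviation E into a deviation G with s·G(n) = Q·s·E(n) − n.
  perturbed : ℕ → Sign → ℤ
  perturbed a s = + Q ℤ.* + a ℤ.+ unit s

  perturbed-dev : ∀ a b′ s n → unit s ℤ.* dev (perturbed a s) (Q * suc b′) n
                               ≡ + Q ℤ.* (unit s ℤ.* dev (+ a) (suc b′) n) ℤ.- + n
  perturbed-dev a b′ s n = begin
    u ℤ.* dev (perturbed a s) (Q * suc b′) n
      ≡⟨ cong (λ x → u ℤ.* (x ℤ.* + T n ℤ.- perturbed a s ℤ.* + n)) (ℤ.pos-* Q (suc b′)) ⟩
    u ℤ.* ((+ Q ℤ.* + suc b′) ℤ.* + T n ℤ.- (+ Q ℤ.* + a ℤ.+ u) ℤ.* + n)
      ≡⟨ expand u (+ Q) (+ suc b′) (+ T n) (+ a) (+ n) ⟩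
    + Q ℤ.* (u ℤ.* dev (+ a) (suc b′) n) ℤ.- (u ℤ.* u) ℤ.* + n
      ≡⟨ cong (λ x → + Q ℤ.* (u ℤ.* dev (+ a) (suc b′) n) ℤ.- x ℤ.* + n) (unit-square s) ⟩
    + Q ℤ.* (u ℤ.* dev (+ a) (suc b′) n) ℤ.- 1ℤ ℤ.* + n
      ≡⟨ cong (λ x → + Q ℤ.* (u ℤ.* dev (+ a) (suc b′) n) ℤ.- x) (ℤ.*-identityˡ (+ n)) ⟩
    + Q ℤ.* (u ℤ.* dev (+ a) (suc b′) n) ℤ.- + n ∎
    where
      open ≡-Reasoning
      u = unit s
      expand : ∀ u q b t a n → u ℤ.* ((q ℤ.* b) ℤ.* t ℤ.- (q ℤ.* a ℤ.+ u) ℤ.* n)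
                               ≡ q ℤ.* (u ℤ.* (b ℤ.* t ℤ.- a ℤ.* n)) ℤ.- (u ℤ.* u) ℤ.* n
      expand = ℤSolver.solve-∀

  -- If s·E(n) ≥ X and Q·s·E(B) ≤ B for
  -- some n ≤ B < Q·X, then s·G is positive at n and non-positive at B, so it
  -- drops to ≤ 0 at some e ∈ (n, B]; there |G e| is smaller than one step of G.
  crossing : ∀ a b′ s {n B X} → n ≤ B → B < Q * X →
             + X ℤ.≤ unit s ℤ.* dev (+ a) (suc b′) n →
             unit s ℤ.* (+ Q ℤ.* dev (+ a) (suc b′) B) ℤ.≤ + B →
             Σ ℕ λ e → n < e × e ≤ B ×
               ℤ.∣ dev (perturbed a s) (Q * suc b′) e ∣ < (Q * suc b′) * D + ℤ.∣ perturbed a s ∣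
  crossing a b′ s {n} {B} {X} n≤B B<QX far near =
    drop (last-before-exit (λ m → 0ℤ ℤ.<? sG m) n≤B start end)
    where
      E G sG : ℕ → ℤ
      E  = dev (+ a) (suc b′)
      G  = dev (perturbed a s) (Q * suc b′)
      sG m = unit s ℤ.* G m
      start : 0ℤ ℤ.< sG n
      start = subst (0ℤ ℤ.<_) (sym (perturbed-dev a b′ s n)) (0<i-j (begin-strict
        + n                          <⟨ ℤ.+<+ (ℕ.≤-<-trans n≤B B<QX) ⟩
        + (Q * X)                    ≡⟨ ℤ.pos-* Q X ⟩
        + Q ℤ.* + X                  ≤⟨ ℤ.*-monoˡ-≤-nonNeg (+ Q) far ⟩
        + Q ℤ.* (unit s ℤ.* E n)     ∎))
        where open ℤ.≤-Reasoning
      end : ¬ (0ℤ ℤ.< sG B)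
      end = ℤ.≤⇒≯ (subst (ℤ._≤ 0ℤ) (sym (perturbed-dev a b′ s B))
              (ℤ.i≤j⇒i-j≤0 (subst (ℤ._≤ + B) (commute (unit s) (+ Q) (E B)) near)))
        where
          commute : ∀ u q e → u ℤ.* (q ℤ.* e) ≡ q ℤ.* (u ℤ.* e)
          commute = ℤSolver.solve-∀
      drop : Σ ℕ (λ m → n ≤ m × m < B × 0ℤ ℤ.< sG m × ¬ (0ℤ ℤ.< sG (suc m))) →
             Σ ℕ λ e → n < e × e ≤ B × ℤ.∣ G e ∣ < (Q * suc b′) * D + ℤ.∣ perturbed a s ∣
      drop (m , n≤m , m<B , positive , ¬positive) = suc m , s≤s n≤m , m<B , (begin-strict
        ℤ.∣ G (suc m) ∣                         ≡⟨ ∣unit*i∣ s (G (suc m)) ⟨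
        ℤ.∣ sG (suc m) ∣                        <⟨ jump-exceeds positive (ℤ.≮⇒≥ ¬positive) ⟩
        ℤ.∣ sG (suc m) ℤ.- sG m ∣               ≡⟨ cong ℤ.∣_∣ (factor (unit s) (G (suc m)) (G m)) ⟩
        ℤ.∣ unit s ℤ.* (G (suc m) ℤ.- G m) ∣    ≡⟨ ∣unit*i∣ s (G (suc m) ℤ.- G m) ⟩
        ℤ.∣ G (suc m) ℤ.- G m ∣                 ≤⟨ dev-step (perturbed a s) (Q * suc b′) m ⟩
        (Q * suc b′) * D + ℤ.∣ perturbed a s ∣  ∎)
        where
          open ℕ.≤-Reasoning
          factor : ∀ u x y → u ℤ.* x ℤ.- u ℤ.* y ≡ u ℤ.* (x ℤ.- y)
          factor = ℤSolver.solve-∀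

  -- Window parameters after position A: deviation threshold R, length L (long
  -- enough for the pigeonhole in the flat case), and end point B = L + A.
  radius : ℕ → ℕ
  radius A = suc A

  windowLength : ℕ → ℕ
  windowLength A = suc (k * length (intRange (radius A)))

  windowEnd : ℕ → ℕ
  windowEnd A = windowLength A + A

  -- B < Q·(R + 1): this is what the choice Q = 4k + 1 is for.
  windowEnd<Q*radius : ∀ A → windowEnd A < Q * suc (radius A)
  windowEnd<Q*radius A = begin-strict
    windowEnd A                                        ≡⟨ cong (λ l → suc (k * l) + A) (length-intRange (radius A)) ⟩
    suc (k * (suc (suc A) + suc A)) + A                <⟨ ℕ.m≤m+n (suc (suc (k * (suc (suc A) + suc A)) + A)) _ ⟩
    suc (suc (k * (suc (suc A) + suc A)) + A) + (k * (A + A) + 5 * k) ≡⟨ count k A ⟨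
    Q * suc (radius A)                                 ∎
    where
      open ℕ.≤-Reasoning
      count : ∀ k A → suc (4 * k) * suc (suc A)
                      ≡ suc (suc (k * (suc (suc A) + suc A)) + A) + (k * (A + A) + 5 * k)
      count = solve-∀

  scaled-dev : ∀ a b N → + Q ℤ.* dev (+ a) b N ≡ (Q * (b * T N)) ⊖ (Q * (a * N))
  scaled-dev a b N = begin
    + Q ℤ.* (+ b ℤ.* + T N ℤ.- + a ℤ.* + N)                 ≡⟨ distrib (+ Q) (+ b ℤ.* + T N) (+ a ℤ.* + N) ⟩
    + Q ℤ.* (+ b ℤ.* + T N) ℤ.- + Q ℤ.* (+ a ℤ.* + N)       ≡⟨ cong₂ (λ x y → + Q ℤ.* x ℤ.- + Q ℤ.* y) (ℤ.pos-* b (T N)) (ℤ.pos-* a N) ⟨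
    + Q ℤ.* + (b * T N) ℤ.- + Q ℤ.* + (a * N)               ≡⟨ cong₂ (λ x y → x ℤ.- y) (ℤ.pos-* Q (b * T N)) (ℤ.pos-* Q (a * N)) ⟨
    + (Q * (b * T N)) ℤ.- + (Q * (a * N))                   ≡⟨ ℤ.m-n≡m⊖n (Q * (b * T N)) (Q * (a * N)) ⟩
    (Q * (b * T N)) ⊖ (Q * (a * N))                         ∎
    where
      open ≡-Reasoning
      distrib : ∀ q x y → q ℤ.* (x ℤ.- y) ≡ q ℤ.* x ℤ.- q ℤ.* y
      distrib = ℤSolver.solve-∀

  -- A colour (b′, a, s, v) names the perturbed slope (Q·a + s)/(Q·(b′+1)) and a value v.
  Colour : Set
  Colour = ℕ × ℕ × Sign × ℤ

  OnLine : Colour → ℕ → Set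
  OnLine (b′ , a , s , v) n = dev (perturbed a s) (Q * suc b′) n ≡ v

  record Event : Set where
    constructor event
    field
      position : ℕ
      colour   : Colour
      on-line  : OnLine colour position
  open Event

  valueBound : ℕ
  valueBound = (Q * Q) * D + Q * (Q * D)

  colours : List Colour
  colours = cartesianProduct (upTo Q) (cartesianProduct (upTo (suc (Q * D)))
              (cartesianProduct (Sign.+ ∷ Sign.- ∷ []) (intRange valueBound)))

  colour-∈ : ∀ {b′ a} s v → b′ < Q → a ≤ Q * D → ℤ.∣ v ∣ ≤ valueBound → (b′ , a , s , v) ∈ colours
  colour-∈ s v b′<Q a≤QD v≤ = ∈-cartesianProduct⁺ (∈-upTo⁺ b′<Q) (∈-cartesianProduct⁺ (∈-upTo⁺ (s≤s a≤QD))
                                (∈-cartesianProduct⁺ (sign-∈ s) (∈-intRange v v≤)))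
    where
      sign-∈ : ∀ s → s ∈ Sign.+ ∷ Sign.- ∷ []
      sign-∈ Sign.+ = here refl
      sign-∈ Sign.- = there (here refl)

  value-bound : ∀ {b′ a} s v → b′ < Q → a ≤ Q * D →
                ℤ.∣ v ∣ < (Q * suc b′) * D + ℤ.∣ perturbed a s ∣ → ℤ.∣ v ∣ ≤ valueBound
  value-bound {b′} {a} s v b′<Q a≤QD v< = ℕ.≤-pred (begin
    suc ℤ.∣ v ∣                                    ≤⟨ v< ⟩
    (Q * suc b′) * D + ℤ.∣ perturbed a s ∣         ≤⟨ ℕ.+-mono-≤ (ℕ.*-monoˡ-≤ D (ℕ.*-monoʳ-≤ Q b′<Q)) numerator ⟩
    (Q * Q) * D + suc (Q * (Q * D))                ≡⟨ ℕ.+-suc ((Q * Q) * D) (Q * (Q * D)) ⟩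
    suc valueBound                                 ∎)
    where
      open ℕ.≤-Reasoning
      ∣unit∣ : ∀ s → ℤ.∣ unit s ∣ ≡ 1
      ∣unit∣ Sign.+ = refl
      ∣unit∣ Sign.- = refl
      numerator : ℤ.∣ perturbed a s ∣ ≤ suc (Q * (Q * D))
      numerator = begin
        ℤ.∣ perturbed a s ∣                      ≤⟨ ℤ.∣i+j∣≤∣i∣+∣j∣ (+ Q ℤ.* + a) (unit s) ⟩
        ℤ.∣ + Q ℤ.* + a ∣ + ℤ.∣ unit s ∣          ≡⟨ cong₂ _+_ (ℤ.abs-* (+ Q) (+ a)) (∣unit∣ s) ⟩
        Q * a + 1                                ≤⟨ ℕ.+-monoˡ-≤ 1 (ℕ.*-monoʳ-≤ Q a≤QD) ⟩
        Q * (Q * D) + 1                          ≡⟨ ℕ.+-comm (Q * (Q * D)) 1 ⟩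
        suc (Q * (Q * D))                        ∎

  -- An excursion of the deviation from a Dirichlet approximation a/(b′+1) of
  -- T(B)/B beyond the radius, at n ∈ (A, B], yields an event in (A, B]: apply
  -- the crossing lemma with s the sign of the excursion.
  excursion⇒event : ∀ A b′ a n → suc b′ ≤ Q → a ≤ Q * D →
    ℤ.∣ (Q * (suc b′ * T (windowEnd A))) ⊖ (Q * (a * windowEnd A)) ∣ < windowEnd A →
    A < n → n ≤ windowEnd A → radius A < ℤ.∣ dev (+ a) (suc b′) n ∣ →
    Σ Event λ e → A < position e × position e ≤ windowEnd A × colour e ∈ colours
  excursion⇒event A b′ a n b≤Q a≤QD close A<n n≤B far =
    let (s , aligned)           = unit*i≡∣i∣ (E n)
        (e , n<e , e≤B , small) = crossing a b′ s n≤B (windowEnd<Q*radius A)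
                                    (subst (+ suc (radius A) ℤ.≤_) (sym aligned) (ℤ.+≤+ far)) (near s)
        v                       = dev (perturbed a s) (Q * suc b′) e
    in event e (b′ , a , s , v) refl , ℕ.<-trans A<n n<e , e≤B ,
       colour-∈ s v b≤Q a≤QD (value-bound s v b≤Q a≤QD small)
    where
      B = windowEnd A
      E = dev (+ a) (suc b′)
      -- ±Q·E(B) ≤ |Q·E(B)| < B by the choice of a/(b′+1)
      near : ∀ s → unit s ℤ.* (+ Q ℤ.* E B) ℤ.≤ + B
      near s = ℤ.≤-trans (unit*i≤∣i∣ s (+ Q ℤ.* E B))
                 (ℤ.+≤+ (ℕ.<⇒≤ (subst (_< B) (cong ℤ.∣_∣ (sym (scaled-dev a (suc b′) B))) close)))

  event-in-window : ∀ A → EqualAverageBlocks ⊎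
                    Σ Event λ e → A < position e × position e ≤ windowEnd A × colour e ∈ colours
  event-in-window A = approximate (dirichlet Q B (T B))
    where
      B = windowEnd A
      approximate : Σ ℕ (λ b → Σ ℕ λ a → 1 ≤ b × b ≤ Q × a * B ≤ Q * T B ×
                      ℤ.∣ (Q * (b * T B)) ⊖ (Q * (a * B)) ∣ < B) →
                    EqualAverageBlocks ⊎ Σ Event λ e → A < position e × position e ≤ B × colour e ∈ colours
      approximate (zero , _ , () , _)
      approximate (suc b′ , a , _ , b≤Q , aB≤QT , close) =
        Sum.map₂ (λ (n , A<n , n≤B , far) → excursion⇒event A b′ a n b≤Q a≤QD close A<n n≤B far)
                 (flat-or-excursion (+ a) (suc b′) A (windowLength A) (radius A) ℕ.≤-refl)
        where
          -- a·B ≤ Q·T(B) ≤ Q·D·B bounds the numerator a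
          a≤QD : a ≤ Q * D
          a≤QD = ℕ.*-cancelʳ-≤ a (Q * D) B (ℕ.≤-trans aB≤QT (ℕ.≤-trans (ℕ.*-monoʳ-≤ Q (T-bound B))
                   (ℕ.≤-reflexive (sym (ℕ.*-assoc Q D B)))))

  windowStart : ℕ → ℕ
  windowStart zero    = 0
  windowStart (suc i) = windowEnd (windowStart i)

  Later : Event → Event → Set
  Later e e′ = position e < position e′

  Events : ℕ → ℕ → Set
  Events cnt i = Σ (List Event) λ es → Linked Later es × All (λ e → colour e ∈ colours) es ×
                   All (λ e → windowStart i < position e) es × length es ≡ cnt

  collect : ∀ cnt i → EqualAverageBlocks ⊎ Events cnt i
  collect zero    i = inj₂ ([] , [] , [] , [] , refl)
  collect (suc cnt) i with event-in-window (windowStart i)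
  ... | inj₁ blocks = inj₁ blocks
  ... | inj₂ (e , after , inside , coloured) with collect cnt (suc i)
  ...   | inj₁ blocks = inj₁ blocks
  ...   | inj₂ (es , chain , colouredₛ , afterₛ , count) =
    inj₂ (e ∷ es , prepend afterₛ chain , coloured ∷ colouredₛ ,
          after ∷ All.map (ℕ.<-trans after ∘ ℕ.≤-<-trans inside) afterₛ , cong suc count)
    where
      prepend : ∀ {es} → All (λ e′ → windowStart (suc i) < position e′) es → Linked Later es → Linked Later (e ∷ es)
      prepend []           []    = [-]
      prepend (e<e′ ∷ _) chain = ℕ.≤-<-trans inside e<e′ ∷ chain

  _≟colour_ : DecidableEquality Colour
  _≟colour_ = ≡-dec ℕ._≟_ (≡-dec ℕ._≟_ (≡-dec Sign._≟_ ℤ._≟_))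

  equal-average-blocks : EqualAverageBlocks
  equal-average-blocks with collect (suc (k * length colours)) 0
  ... | inj₁ blocks = blocks
  ... | inj₂ (es , chain , coloured , _ , count)
    with Pigeonhole.pigeonhole _≟colour_ colour ℕ.<-trans k colours es chain coloured
           (subst (k * length colours <_) (sym count) ℕ.≤-refl)
  ... | (b′ , a , s , v) , ys , _ , chain′ , same , many =
    collinear⇒blocks (perturbed a s) (Q * suc b′) v (map position ys) (Linked.map⁺ chain′)
      (All.map⁺ (All.map (λ {e} eq → subst (λ c → OnLine c (position e)) eq (on-line e)) same))
      (subst (k <_) (sym (List.length-map position ys)) many)

∈⇒bounded : ∀ {x} S → x ∈ S → ℤ.∣ x ∣ ≤ sum (map ℤ.∣_∣ S)
∈⇒bounded (y ∷ S) (here refl) = ℕ.m≤m+n _ _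
∈⇒bounded (y ∷ S) (there x∈S) = ℕ.≤-trans (∈⇒bounded S x∈S) (ℕ.m≤n+m _ _)

-- The argument works for every k.
mainTheorem2 : (S : List ℤ) (ω : Word) → (∀ i → ω i ∈ S) → (k : ℕ) → 1 < k →
    Σ ℕ λ p → Σ (Fin k → ℕ) λ ℓ →
      ∀ (i j : Fin k) → blockAverage ω p ℓ i ≃ blockAverage ω p ℓ j
mainTheorem2 S ω letters k _ = Blocks.equal-average-blocks ω (sum (map ℤ.∣_∣ S)) (λ i → ∈⇒bounded S (letters i)) k
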